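{- Let $X$ be a set and $R\subseteq X\times X$. (i) If $R$ is anti-transitive then $R$ is irreflexive. (ii) If $R$ is anti-transitive then the protection relation $\sqsupset_R$ is consistent. (iii) Irreflexivity of $R$ does not in general imply anti-transitivity of $R$. (iv) Consistency of $\sqsupset_R$ does not in general imply anti-transitivity of $R$.
   Context: $R$ is anti-transitive iff $\forall x,y,z\in X\,((xRy\wedge yRz)\Rightarrow\neg xRz)$; irreflexive iff $\forall x.\ \neg xRx$. The protection relation induced by $R$ is defined by $x \sqsupset_R z$ iff $\forall y\in X\,(yRz \Rightarrow xRy)$; it is consistent iff $\forall x,y\in X\,(x\sqsupset_R y\Rightarrow\neg xRy)$. Statements (iii) and (iv) assert the existence of some set $X$ and relation $R$ witnessing the failure. -}

module Defs where

open import Data.Product using (_×_)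
open import Relation.Nullary using (¬_)

AntiTransitive : {X : Set} → (X → X → Set) → Set
AntiTransitive {X} R = ∀ (x y z : X) → (R x y × R y z) → ¬ R x z

Irreflexive : {X : Set} → (X → X → Set) → Set
Irreflexive {X} R = ∀ (x : X) → ¬ R x x

Protects : {X : Set} → (X → X → Set) → X → X → Set
Protects {X} R x z = ∀ (y : X) → R y z → R x y

ProtectionConsistent : {X : Set} → (X → X → Set) → Set
ProtectionConsistent {X} R = ∀ (x y : X) → Protects R x y → ¬ R x y

module Submission where

open import Defs
open import Data.Product using (_×_; Σ; _,_)
open import Relation.Nullary using (¬_)
open import Data.Nat using (ℕ; _<_; s≤s; z≤n)
open import Data.Nat.Properties using (<-irrefl)
open import Relation.Binary.PropositionalEquality using (refl)

-- If x ⊐ y and x R y, then instantiating the protection at y = x yields x R x;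
-- so consistency is already implied by irreflexivity, and the strict order on ℕ
-- witnesses both non-implications.

antiTransitive⇒irreflexive : {X : Set} (R : X → X → Set) → AntiTransitive R → Irreflexive R
antiTransitive⇒irreflexive R antiTrans x xRx = antiTrans x x x (xRx , xRx) xRx

irreflexive⇒protectionConsistent : {X : Set} (R : X → X → Set) → Irreflexive R → ProtectionConsistent R
irreflexive⇒protectionConsistent R irrefl x y x⊐y xRy = irrefl x (x⊐y x xRy)

<-irreflexive : Irreflexive _<_
<-irreflexive n = <-irrefl refl

<-¬antiTransitive : ¬ AntiTransitive _<_
<-¬antiTransitive antiTrans = antiTrans 0 1 2 (s≤s z≤n , s≤s (s≤s z≤n)) (s≤s z≤n)

mainTheorem16 : ((X : Set) (R : X → X → Set) → AntiTransitive R → Irreflexive R)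
    × ((X : Set) (R : X → X → Set) → AntiTransitive R → ProtectionConsistent R)
    × Σ Set (λ X → Σ (X → X → Set) (λ R → Irreflexive R × ¬ AntiTransitive R))
    × Σ Set (λ X → Σ (X → X → Set) (λ R → ProtectionConsistent R × ¬ AntiTransitive R))
mainTheorem16 =
    (λ X R → antiTransitive⇒irreflexive R)
  , (λ X R antiTrans → irreflexive⇒protectionConsistent R (antiTransitive⇒irreflexive R antiTrans))
  , (ℕ , _<_ , <-irreflexive , <-¬antiTransitive)
  , (ℕ , _<_ , irreflexive⇒protectionConsistent _<_ <-irreflexive , <-¬antiTransitive)
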